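{- Let $\alpha\in\mathbb{R}\setminus\mathbb{Q}$ with continued fraction expansion $\alpha=[a_0;a_1,a_2,\dots]$. Then $\overline{g}(\alpha)=3$ if $a_n=1$ for infinitely many $n$, and $\overline{g}(\alpha)=2$ otherwise.
   Context: On $\mathbb{T}=\mathbb{R}/\mathbb{Z}$ let $dist(x,y)=\min_{t\in\mathbb{Z}}|x-y-t|$. For integers $N\ge1$ and $0\le q\le N$ put $D_q(N)=\min\{dist(q\alpha,k\alpha): 0\le k\le N,k\ne q\}$, let $g(\alpha,N)$ be the number of distinct values among $D_0(N),\dots,D_N(N)$, and $\overline{g}(\alpha)=\limsup_{N\to\infty}g(\alpha,N)$. -}

module Defs where

open import Data.Nat using (ℕ; zero; suc) renaming (_≤_ to _≤ℕ_)
open import Data.Integer using (ℤ; +_; _+_; _-_; _*_; -_; _<_)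
open import Data.Fin using (Fin)
open import Data.Product using (Σ; ∃; ∃-syntax; _×_; _,_; proj₁; proj₂)
open import Data.Sum using (_⊎_)
open import Relation.Nullary using (¬_)
open import Relation.Binary.PropositionalEquality using (_≡_)

-- An irrational α is given by its (infinite) continued fraction
-- α = [a₀; a₁, a₂, …] with a₀ ∈ ℤ and aₙ ≥ 1 for n ≥ 1.
-- Here a₀ is 'a0' and a_{n+1} is 'as n'.

pq : ℤ → (ℕ → ℕ) → ℕ → ℤ
pq a0 as zero    = a0
pq a0 as (suc n) = + as n

-- convergents: conv n = (pₙ , qₙ , pₙ₋₁ , qₙ₋₁), with p₋₁ = 1, q₋₁ = 0
record Conv : Set where
  constructor conv4
  field p q p' q' : ℤ

conv : ℤ → (ℕ → ℕ) → ℕ → Conv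
conv a0 as zero = conv4 a0 (+ 1) (+ 1) (+ 0)
conv a0 as (suc n) with conv a0 as n
... | conv4 p q p' q' = conv4 (+ as n * p + p') (+ as n * q + q') p q

-- A "linear form" (m , t) stands for the real number  m·α − t.
LF : Set
LF = ℤ × ℤ

_⊖_ : LF → LF → LF
(m , t) ⊖ (m' , t') = (m - m' , t - t')

_⊕_ : LF → LF → LF
(m , t) ⊕ (m' , t') = (m + m' , t + t')

neg : LF → LF
neg (m , t) = (- m , - t)

-- m·α − t > 0, where α = lim pₙ/qₙ (qₙ > 0): the sign of m·pₙ/qₙ − t
-- is eventually that of m·α − t (since α is irrational, this is exact).
Pos : ℤ → (ℕ → ℕ) → LF → Set
Pos a0 as (m , t) =
  ∃[ M ] ∀ n → M ≤ℕ n →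
    + 0 < m * Conv.p (conv a0 as n) - t * Conv.q (conv a0 as n)

-- |x| < |y| for the real numbers represented by x and y
AbsLt : ℤ → (ℕ → ℕ) → LF → LF → Set
AbsLt a0 as x y =
  (Pos a0 as (y ⊖ x) × Pos a0 as (y ⊕ x))
  ⊎ (Pos a0 as (x ⊖ y) × Pos a0 as (neg (x ⊕ y)))

AbsEq : ℤ → (ℕ → ℕ) → LF → LF → Set
AbsEq a0 as x y = ¬ AbsLt a0 as x y × ¬ AbsLt a0 as y x

-- dist(qα, kα) = min_{t∈ℤ} |qα − kα − t|, and
-- D_q(N) = min { dist(qα,kα) : 0 ≤ k ≤ N, k ≠ q }.
-- 'IsD a0 as N q x' : the linear form x = (q−k)α − t realises D_q(N),
-- i.e. |x| = D_q(N).

IsD : ℤ → (ℕ → ℕ) → ℕ → ℕ → LF → Set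
IsD a0 as N q x =
  (∃[ k ] (k ≤ℕ N × ¬ (k ≡ q) × proj₁ x ≡ (+ q - + k)))
  × (∀ k → k ≤ℕ N → ¬ (k ≡ q) → ∀ t →
       ¬ AbsLt a0 as (+ q - + k , t) x)

SameD : ℤ → (ℕ → ℕ) → ℕ → ℕ → ℕ → Set
SameD a0 as N i j = ∀ x y → IsD a0 as N i x → IsD a0 as N j y → AbsEq a0 as x y

DiffD : ℤ → (ℕ → ℕ) → ℕ → ℕ → ℕ → Set
DiffD a0 as N i j =
  ∃[ x ] ∃[ y ] (IsD a0 as N i x × IsD a0 as N j y × ¬ AbsEq a0 as x y)

gAtLeast : ℤ → (ℕ → ℕ) → ℕ → ℕ → Set
gAtLeast a0 as N c =
  Σ (Fin c → ℕ) λ f →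
    (∀ i → f i ≤ℕ N)
    × (∀ i j → ¬ (i ≡ j) → DiffD a0 as N (f i) (f j))

gAtMost : ℤ → (ℕ → ℕ) → ℕ → ℕ → Set
gAtMost a0 as N c =
  ∀ (f : Fin (suc c) → ℕ) → (∀ i → f i ≤ℕ N) →
    ∃[ i ] ∃[ j ] (¬ (i ≡ j) × SameD a0 as N (f i) (f j))

-- limsup_{N→∞} g(α,N) = c  (g is integer valued):
-- eventually g ≤ c, and g ≥ c for infinitely many N
LimsupG : ℤ → (ℕ → ℕ) → ℕ → Set
LimsupG a0 as c =
  (∃[ M ] ∀ N → M ≤ℕ N → gAtMost a0 as N c)
  × (∀ M → ∃[ N ] (M ≤ℕ N × gAtLeast a0 as N c))

InfManyOnes : ℤ → (ℕ → ℕ) → Set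
InfManyOnes a0 as = ∀ M → ∃[ n ] (M ≤ℕ n × pq a0 as n ≡ + 1)

FinManyOnes : ℤ → (ℕ → ℕ) → Set
FinManyOnes a0 as = ∃[ M ] ∀ n → M ≤ℕ n → ¬ (pq a0 as n ≡ + 1)

{-# OPTIONS --safe #-}

-- In coordinates (m pₙ₋₁ − t qₙ₋₁, m pₙ − t qₙ) at the n-th convergent, the recurrence
-- of the convergents preserves the cone of nonnegative coordinates, so a form mα − t is
-- positive once its coordinates lie there.  This yields best approximation: if
-- 0 < |m| < qₙ then |mα − t| ≥ |qₙ₋₁α − pₙ₋₁|, with equality only at ±(qₙ₋₁α − pₙ₋₁).
-- Hence D_q(N) = |qₙ₋₁α − pₙ₋₁| for qₙ₋₁ ≤ max(q, N − q) < qₙ, and these values strictly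
-- decrease in n.  As max(q, N − q) ranges over [N/2, N] and q_{k+2} ≥ 2 q_k, at most three
-- values occur, and at most two once a_{k+1} ≥ 2 (then q_{k+1} ≥ 2 q_k).  Conversely
-- N = q_{k+1} and q ∈ {N − 1, N} give two values, and if a_{k+1} = 1 then
-- N = q_k + q_{k−1} and q ∈ {q_k − 1, q_k, N} give three.

module Submission where

open import Defs
open import Data.Nat using (ℕ; _≤_)
open import Data.Integer using (ℤ)
open import Data.Product using (_×_)

open import Data.Nat as ℕ using (zero; suc; z≤n; s≤s; _<_; _⊔_; _∸_; _≤′_; ≤′-refl; ≤′-step)
import Data.Nat.Properties as ℕₚ
open import Data.Integer as ℤ using (+_; +0; +[1+_]; -[1+_]; _+_; _-_; _*_; -_; ∣_∣; +≤+; +<+; -≤+; -<+)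
import Data.Integer.Properties as ℤₚ
open import Data.Integer.Tactic.RingSolver using (solve-∀)
open import Data.Fin as Fin using (Fin; toℕ; zero; suc)
import Data.Fin.Properties as Finₚ
open import Data.Product using (∃; ∃-syntax; _,_; proj₁; proj₂; swap)
open import Data.Sum using (_⊎_; inj₁; inj₂)
import Data.Sum as Sum
open import Data.Empty using (⊥-elim)
open import Relation.Nullary using (¬_; yes; no; contradiction)
open import Relation.Binary using (tri<; tri≈; tri>)
open import Relation.Binary.PropositionalEquality
open import Function using (_∘_; id)

private
  variable
    k m n n₁ n₂ N q i j : ℕ
    u v w x y z : LF

0ᶠ : LF
0ᶠ = + 0 , + 0

neg-involutive : ∀ x → neg (neg x) ≡ x
neg-involutive (m , t) = cong₂ _,_ (ℤₚ.neg-involutive m) (ℤₚ.neg-involutive t)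

⊕-comm : ∀ x y → x ⊕ y ≡ y ⊕ x
⊕-comm (m , t) (m′ , t′) = cong₂ _,_ (ℤₚ.+-comm m m′) (ℤₚ.+-comm t t′)

⊖-self : ∀ x → x ⊖ x ≡ 0ᶠ
⊖-self (m , t) = cong₂ _,_ (ℤₚ.+-inverseʳ m) (ℤₚ.+-inverseʳ t)

⊖-neg : ∀ x y → x ⊖ neg y ≡ x ⊕ y
⊖-neg (m , t) (m′ , t′) =
  cong₂ _,_ (cong (_+_ m) (ℤₚ.neg-involutive m′)) (cong (_+_ t) (ℤₚ.neg-involutive t′))

neg-⊖ : ∀ x y → neg (x ⊖ y) ≡ y ⊖ x
neg-⊖ (m , t) (m′ , t′) = cong₂ _,_ (lemma m m′) (lemma t t′)
  where
  lemma : ∀ a b → - (a - b) ≡ b - a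
  lemma = solve-∀

neg-distrib-⊕ : ∀ x y → neg (x ⊕ y) ≡ neg x ⊖ y
neg-distrib-⊕ (m , t) (m′ , t′) = cong₂ _,_ (ℤₚ.neg-distrib-+ m m′) (ℤₚ.neg-distrib-+ t t′)

infix 4 _≡±_
_≡±_ : LF → LF → Set
x ≡± z = x ≡ z ⊎ x ≡ neg z

≡±-sym : x ≡± z → z ≡± x
≡±-sym (inj₁ x≡z) = inj₁ (sym x≡z)
≡±-sym {x} {z} (inj₂ x≡-z) = inj₂ (trans (sym (neg-involutive z)) (cong neg (sym x≡-z)))

neg-≡± : neg x ≡± z → x ≡± z
neg-≡± {x} (inj₁ -x≡z) = inj₂ (trans (sym (neg-involutive x)) (cong neg -x≡z))
neg-≡± {x} {z} (inj₂ -x≡-z) =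
  inj₁ (trans (sym (neg-involutive x)) (trans (cong neg -x≡-z) (neg-involutive z)))

ev : ℤ → ℤ → LF → ℤ
ev p q (m , t) = m * p - t * q

ev-⊖ : ∀ p q x y → ev p q (x ⊖ y) ≡ ev p q x - ev p q y
ev-⊖ p q (m , t) (m′ , t′) = lemma m t m′ t′ p q
  where
  lemma : ∀ m t m′ t′ p q → (m - m′) * p - (t - t′) * q ≡ (m * p - t * q) - (m′ * p - t′ * q)
  lemma = solve-∀

ev-neg : ∀ p q x → ev p q (neg x) ≡ - ev p q x
ev-neg p q (m , t) = lemma m t p q
  where
  lemma : ∀ m t p q → (- m) * p - (- t) * q ≡ - (m * p - t * q)
  lemma = solve-∀

ev-step : ∀ a p q p′ q′ x → ev (a * p + p′) (a * q + q′) x ≡ a * ev p q x + ev p′ q′ x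
ev-step a p q p′ q′ (m , t) = lemma m t a p q p′ q′
  where
  lemma : ∀ m t a p q p′ q′ →
          m * (a * p + p′) - t * (a * q + q′) ≡ a * (m * p - t * q) + (m * p′ - t * q′)
  lemma = solve-∀

IsUnit : ℤ → Set
IsUnit e = e ≡ + 1 ⊎ e ≡ - + 1

IsUnit-neg : ∀ {e} → IsUnit e → IsUnit (- e)
IsUnit-neg (inj₁ refl) = inj₂ refl
IsUnit-neg (inj₂ refl) = inj₁ refl

∣i*e∣≡∣i∣ : ∀ i {e} → IsUnit e → ∣ i * e ∣ ≡ ∣ i ∣
∣i*e∣≡∣i∣ i (inj₁ refl) = trans (ℤₚ.abs-* i (+ 1)) (ℕₚ.*-identityʳ ∣ i ∣)
∣i*e∣≡∣i∣ i (inj₂ refl) = trans (ℤₚ.abs-* i (- + 1)) (ℕₚ.*-identityʳ ∣ i ∣)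

0<a*e+e′ˡ : ∀ {a e e′} → 1 ≤ a → + 0 ℤ.< e → + 0 ℤ.≤ e′ → + 0 ℤ.< + a * e + e′
0<a*e+e′ˡ {suc a} _ (+<+ (s≤s z≤n)) (+≤+ z≤n) = +<+ (s≤s z≤n)

0<a*e+e′ʳ : ∀ a {e e′} → + 0 ℤ.≤ e → + 0 ℤ.< e′ → + 0 ℤ.< + a * e + e′
0<a*e+e′ʳ a (+≤+ {n = e} z≤n) 0<e′ =
  ℤₚ.+-mono-≤-< (subst (+ 0 ℤ.≤_) (ℤₚ.pos-* a e) (+≤+ z≤n)) 0<e′

decrement-cases : ∀ {a b} → + 0 ℤ.≤ a → + 0 ℤ.< b →
  (+ 0 ℤ.≤ b - + 1 × (+ 0 ℤ.< a ⊎ + 0 ℤ.< b - + 1)) ⊎ (a ≡ + 0 × b ≡ + 1)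
decrement-cases {+ zero}  {+[1+ zero ]}  _ _ = inj₂ (refl , refl)
decrement-cases {+ suc _} {+[1+ _ ]}     _ _ = inj₁ (+≤+ z≤n , inj₁ (+<+ (s≤s z≤n)))
decrement-cases {+ _}     {+[1+ suc _ ]} _ _ = inj₁ (+≤+ z≤n , inj₂ (+<+ (s≤s z≤n)))
decrement-cases {+ _}     {+0}           _ (+<+ ())

private
  ∣cross∣⁺ : ∀ q q′ k j → ∣ + suc k * + q - (- + j) * + q′ ∣ ≡ suc k ℕ.* q ℕ.+ j ℕ.* q′
  ∣cross∣⁺ q q′ k j = cong ∣_∣ (begin
    + suc k * + q - (- + j) * + q′   ≡⟨ lemma (+ suc k) (+ q) (+ j) (+ q′) ⟩
    + suc k * + q + + j * + q′       ≡⟨ cong₂ _+_ (ℤₚ.pos-* (suc k) q) (ℤₚ.pos-* j q′) ⟨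
    + (suc k ℕ.* q) + + (j ℕ.* q′)   ≡⟨ ℤₚ.pos-+ (suc k ℕ.* q) (j ℕ.* q′) ⟨
    + (suc k ℕ.* q ℕ.+ j ℕ.* q′)     ∎)
    where
    open ≡-Reasoning
    lemma : ∀ a b c d → a * b - (- c) * d ≡ a * b + c * d
    lemma = solve-∀

  ∣cross∣⁻ : ∀ q q′ k j → ∣ (- + suc k) * + q - + j * + q′ ∣ ≡ suc k ℕ.* q ℕ.+ j ℕ.* q′
  ∣cross∣⁻ q q′ k j = begin
    ∣ (- + suc k) * + q - + j * + q′ ∣       ≡⟨ cong ∣_∣ (lemma (+ suc k) (+ q) (+ j) (+ q′)) ⟩
    ∣ - (+ suc k * + q - (- + j) * + q′) ∣   ≡⟨ ℤₚ.∣-i∣≡∣i∣ (+ suc k * + q - (- + j) * + q′) ⟩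
    ∣ + suc k * + q - (- + j) * + q′ ∣       ≡⟨ ∣cross∣⁺ q q′ k j ⟩
    suc k ℕ.* q ℕ.+ j ℕ.* q′                 ∎
    where
    open ≡-Reasoning
    lemma : ∀ a b c d → (- a) * b - c * d ≡ - (a * b - (- c) * d)
    lemma = solve-∀

  q≤cross : ∀ q q′ k j → q ≤ suc k ℕ.* q ℕ.+ j ℕ.* q′
  q≤cross q q′ k j = ℕₚ.≤-trans (ℕₚ.m≤m+n q (k ℕ.* q)) (ℕₚ.m≤m+n _ (j ℕ.* q′))

-- Every other sign pattern of (a, b) makes |a q − b q′| zero or at least q.
small-cross⇒same-sign : ∀ (q q′ : ℕ) a b →
  0 < ∣ a * + q - b * + q′ ∣ → ∣ a * + q - b * + q′ ∣ < q →
  (+ 0 ℤ.≤ a × + 0 ℤ.< b) ⊎ (a ℤ.≤ + 0 × b ℤ.< + 0)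
small-cross⇒same-sign q q′ (+ _)      +[1+ _ ] _ _ = inj₁ (+≤+ z≤n , +<+ (s≤s z≤n))
small-cross⇒same-sign q q′ +0         -[1+ _ ] _ _ = inj₂ (+≤+ z≤n , -<+)
small-cross⇒same-sign q q′ -[1+ _ ]   -[1+ _ ] _ _ = inj₂ (-≤+ , -<+)
small-cross⇒same-sign q q′ +0         +0       () _
small-cross⇒same-sign q q′ +[1+ k ]   +0       _ small =
  contradiction (subst (_< q) (∣cross∣⁺ q q′ k 0) small) (ℕₚ.≤⇒≯ (q≤cross q q′ k 0))
small-cross⇒same-sign q q′ +[1+ k ]   -[1+ j ] _ small =
  contradiction (subst (_< q) (∣cross∣⁺ q q′ k (suc j)) small) (ℕₚ.≤⇒≯ (q≤cross q q′ k (suc j)))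
small-cross⇒same-sign q q′ -[1+ k ]   +0       _ small =
  contradiction (subst (_< q) (∣cross∣⁻ q q′ k 0) small) (ℕₚ.≤⇒≯ (q≤cross q q′ k 0))
small-cross⇒same-sign q q′ -[1+ k ]   +[1+ j ] _ small =
  contradiction (subst (_< q) (∣cross∣⁻ q q′ k (suc j)) small) (ℕₚ.≤⇒≯ (q≤cross q q′ k (suc j)))

m+m≤n+n⇒m≤n : ∀ {a b} → a ℕ.+ a ≤ b ℕ.+ b → a ≤ b
m+m≤n+n⇒m≤n le = ℕₚ.≮⇒≥ (λ b<a → ℕₚ.<⇒≱ (ℕₚ.+-mono-< b<a b<a) le)

≤⊔⇒≤ʳ : ∀ {c a b} → c ≤ a ⊔ b → ¬ (c ≤ a) → c ≤ b
≤⊔⇒≤ʳ c≤a⊔b c≰a = ℕₚ.≮⇒≥ (λ b<c → ℕₚ.<⇒≱ (ℕₚ.⊔-lub (ℕₚ.≰⇒> c≰a) b<c) c≤a⊔b)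

pigeonhole-window : ∀ c k (g : Fin (suc c) → ℕ) → (∀ i → k < g i) → (∀ i → g i ≤ c ℕ.+ k) →
                    ∃[ i ] ∃[ j ] (i ≢ j × g i ≡ g j)
pigeonhole-window c k g above below
  with Finₚ.pigeonhole (ℕₚ.n<1+n c) (λ i → Fin.fromℕ< (offset< i))
  where
  offset< : ∀ i → g i ∸ suc k < c
  offset< i = ℕₚ.+-cancelʳ-< (suc k) (g i ∸ suc k) c
    (subst (_< c ℕ.+ suc k) (sym (ℕₚ.m∸n+n≡m (above i)))
      (ℕₚ.≤-<-trans (below i) (ℕₚ.+-monoʳ-< c (ℕₚ.n<1+n k))))
... | i , j , i<j , same = i , j , Finₚ.<⇒≢ i<j ,
  ℕₚ.∸-cancelʳ-≡ (above i) (above j)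
    (trans (sym (Finₚ.toℕ-fromℕ< _)) (trans (cong toℕ same) (Finₚ.toℕ-fromℕ< _)))

radius : ℕ → ℕ → ℕ
radius N q = q ⊔ (N ∸ q)

radius-≤ : q ≤ N → radius N q ≤ N
radius-≤ {q} {N} q≤N = ℕₚ.⊔-lub q≤N (ℕₚ.m∸n≤m N q)

≤-radius+radius : q ≤ N → N ≤ radius N q ℕ.+ radius N q
≤-radius+radius {q} {N} q≤N = subst (_≤ radius N q ℕ.+ radius N q) (ℕₚ.m+[n∸m]≡n q≤N)
  (ℕₚ.+-mono-≤ (ℕₚ.m≤m⊔n q (N ∸ q)) (ℕₚ.m≤n⊔m q (N ∸ q)))

Offset : ℕ → ℕ → ℤ → Set
Offset N q d = ∃[ k ] (k ≤ N × k ≢ q × d ≡ + q - + k)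

Offset-bounds : ∀ {d} → Offset N q d → 0 < ∣ d ∣ × ∣ d ∣ ≤ radius N q
Offset-bounds {N} {q} (k , k≤N , k≢q , refl) = nonzero , bounded
  where
  nonzero : 0 < ∣ + q - + k ∣
  nonzero = ℕₚ.n≢0⇒n>0 (λ ∣q-k∣≡0 →
    k≢q (sym (ℤₚ.+-injective (ℤₚ.i-j≡0⇒i≡j (+ q) (+ k) (ℤₚ.∣i∣≡0⇒i≡0 ∣q-k∣≡0)))))
  bounded : ∣ + q - + k ∣ ≤ radius N q
  bounded with ℕₚ.≤-total k q
  ... | inj₁ k≤q = subst (_≤ radius N q)
          (sym (cong ∣_∣ (trans (ℤₚ.m-n≡m⊖n q k) (ℤₚ.⊖-≥ k≤q))))
          (ℕₚ.≤-trans (ℕₚ.m∸n≤m q k) (ℕₚ.m≤m⊔n q (N ∸ q)))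
  ... | inj₂ q≤k = subst (_≤ radius N q)
          (sym (trans (cong ∣_∣ (ℤₚ.m-n≡m⊖n q k)) (ℤₚ.∣⊖∣-≤ q≤k)))
          (ℕₚ.≤-trans (ℕₚ.∸-monoˡ-≤ q k≤N) (ℕₚ.m≤n⊔m q (N ∸ q)))

module _ (a0 : ℤ) (as : ℕ → ℕ) where

  P Q P′ Q′ : ℕ → ℤ
  P  n = Conv.p  (conv a0 as n)
  Q  n = Conv.q  (conv a0 as n)
  P′ n = Conv.p' (conv a0 as n)
  Q′ n = Conv.q' (conv a0 as n)

  -- Up to the sign det n, w = E′ n w · (qₙα − pₙ) − E n w · ζ n, so (E′ n w, E n w)
  -- are coordinates of w; ζ n = qₙ₋₁α − pₙ₋₁ itself has coordinates (0, − det n).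
  E E′ : ℕ → LF → ℤ
  E  n = ev (P n) (Q n)
  E′ n = ev (P′ n) (Q′ n)

  E-suc : ∀ n w → E (suc n) w ≡ + as n * E n w + E′ n w
  E-suc n = ev-step (+ as n) (P n) (Q n) (P′ n) (Q′ n)

  E′-suc : ∀ n w → E′ (suc n) w ≡ E n w
  E′-suc n w = refl

  E-⊖ : ∀ n x y → E n (x ⊖ y) ≡ E n x - E n y
  E-⊖ n = ev-⊖ (P n) (Q n)

  E′-⊖ : ∀ n x y → E′ n (x ⊖ y) ≡ E′ n x - E′ n y
  E′-⊖ n = ev-⊖ (P′ n) (Q′ n)

  E-neg : ∀ n x → E n (neg x) ≡ - E n x
  E-neg n = ev-neg (P n) (Q n)

  E′-neg : ∀ n x → E′ n (neg x) ≡ - E′ n x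
  E′-neg n = ev-neg (P′ n) (Q′ n)

  det : ℕ → ℤ
  det n = Q n * P′ n - P n * Q′ n

  det-unit : ∀ n → IsUnit (det n)
  det-unit zero    = inj₁ (cong (_-_ (+ 1)) (ℤₚ.*-zeroʳ a0))
  det-unit (suc n) = subst IsUnit (sym det-suc) (IsUnit-neg (det-unit n))
    where
    lemma : ∀ a p q p′ q′ → (a * q + q′) * p - (a * p + p′) * q ≡ - (q * p′ - p * q′)
    lemma = solve-∀
    det-suc : det (suc n) ≡ - det n
    det-suc = lemma (+ as n) (P n) (Q n) (P′ n) (Q′ n)

  E-inverse₁ : ∀ n w → E′ n w * Q n - E n w * Q′ n ≡ proj₁ w * det n
  E-inverse₁ n (m , t) = lemma m t (P n) (Q n) (P′ n) (Q′ n)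
    where
    lemma : ∀ m t p q p′ q′ → (m * p′ - t * q′) * q - (m * p - t * q) * q′ ≡ m * (q * p′ - p * q′)
    lemma = solve-∀

  E-inverse₂ : ∀ n w → E′ n w * P n - E n w * P′ n ≡ proj₂ w * det n
  E-inverse₂ n (m , t) = lemma m t (P n) (Q n) (P′ n) (Q′ n)
    where
    lemma : ∀ m t p q p′ q′ → (m * p′ - t * q′) * p - (m * p - t * q) * p′ ≡ t * (q * p′ - p * q′)
    lemma = solve-∀

  coordinates-injective : ∀ n → E′ n x ≡ E′ n y → E n x ≡ E n y → x ≡ y
  coordinates-injective {x} {y} n e′ e = cong₂ _,_
      (recover proj₁ (λ a b → a * Q n - b * Q′ n) (E-inverse₁ n))
      (recover proj₂ (λ a b → a * P n - b * P′ n) (E-inverse₂ n))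
    where
    det≢0 : ℤ.NonZero (det n)
    det≢0 with det-unit n
    ... | inj₁ det≡1  = subst ℤ.NonZero (sym det≡1) _
    ... | inj₂ det≡-1 = subst ℤ.NonZero (sym det≡-1) _
    recover : (π : LF → ℤ) (f : ℤ → ℤ → ℤ) → (∀ w → f (E′ n w) (E n w) ≡ π w * det n) → π x ≡ π y
    recover π f inverse = ℤₚ.*-cancelʳ-≡ (π x) (π y) (det n) {{det≢0}}
      (trans (sym (inverse x)) (trans (cong₂ f e′ e) (inverse y)))

  ζ : ℕ → LF
  ζ n = Q′ n , P′ n

  record Axial (n : ℕ) (z : LF) : Set where
    constructor axial
    field
      E′≡0   : E′ n z ≡ + 0
      E-unit : IsUnit (E n z)

  Axial-ζ : ∀ n → Axial n (ζ n)
  Axial-ζ n = axial (lemma₁ (P′ n) (Q′ n))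
    (subst IsUnit (sym (lemma₂ (P n) (Q n) (P′ n) (Q′ n))) (IsUnit-neg (det-unit n)))
    where
    lemma₁ : ∀ p′ q′ → q′ * p′ - p′ * q′ ≡ + 0
    lemma₁ = solve-∀
    lemma₂ : ∀ p q p′ q′ → q′ * p - p′ * q ≡ - (q * p′ - p * q′)
    lemma₂ = solve-∀

  Axial-neg : Axial n z → Axial n (neg z)
  Axial-neg {n} {z} (axial e′ unit) =
    axial (trans (E′-neg n z) (cong -_ e′)) (subst IsUnit (sym (E-neg n z)) (IsUnit-neg unit))

  Axial-≡± : x ≡± z → Axial n z → Axial n x
  Axial-≡± (inj₁ refl) z-axial = z-axial
  Axial-≡± (inj₂ refl) z-axial = Axial-neg z-axial

  den den′ : ℕ → ℕ
  den zero    = 1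
  den (suc n) = as n ℕ.* den n ℕ.+ den′ n
  den′ zero    = 0
  den′ (suc n) = den n

  Q≡den : ∀ n → Q n ≡ + den n
  Q′≡den′ : ∀ n → Q′ n ≡ + den′ n
  Q≡den zero    = refl
  Q≡den (suc n) = begin
    + as n * Q n + Q′ n              ≡⟨ cong₂ (λ a b → + as n * a + b) (Q≡den n) (Q′≡den′ n) ⟩
    + as n * + den n + + den′ n      ≡⟨ cong (_+ + den′ n) (ℤₚ.pos-* (as n) (den n)) ⟨
    + (as n ℕ.* den n) + + den′ n    ≡⟨ ℤₚ.pos-+ (as n ℕ.* den n) (den′ n) ⟨
    + den (suc n)                    ∎
    where open ≡-Reasoning
  Q′≡den′ zero    = refl
  Q′≡den′ (suc n) = Q≡den n

  record Rank (m n : ℕ) : Set where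
    constructor rank
    field
      lower : den′ n ≤ m
      upper : m < den n

  Rank-⊔ : ∀ {a b} → den′ n ≤ a → a < den n → b < den n → Rank (a ⊔ b) n
  Rank-⊔ {a = a} {b} lo a<den b<den = rank (ℕₚ.≤-trans lo (ℕₚ.m≤m⊔n a b)) (ℕₚ.⊔-lub a<den b<den)

  data SameSign (u v : LF) : Set where
    both-pos : Pos a0 as u → Pos a0 as v → SameSign u v
    both-neg : Pos a0 as (neg u) → Pos a0 as (neg v) → SameSign u v

  ¬Pos-0ᶠ : ¬ Pos a0 as 0ᶠ
  ¬Pos-0ᶠ (M , pos) = ℤₚ.<-irrefl refl (pos M ℕₚ.≤-refl)

  Pos⇒¬Pos-neg : ∀ w → Pos a0 as w → ¬ Pos a0 as (neg w)
  Pos⇒¬Pos-neg w (M , pos) (M′ , pos′) = ℤₚ.<-asym (pos late (ℕₚ.m≤m⊔n M M′)) (ℤₚ.neg-cancel-< {+ 0}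
    (subst (+ 0 ℤ.<_) (E-neg late w) (pos′ late (ℕₚ.m≤n⊔m M M′))))
    where late = M ⊔ M′

  SameSign-swap : SameSign u v → SameSign v u
  SameSign-swap (both-pos pos-u pos-v) = both-pos pos-v pos-u
  SameSign-swap (both-neg pos-u pos-v) = both-neg pos-v pos-u

  SameSign-neg : SameSign u v → SameSign (neg u) (neg v)
  SameSign-neg {u} {v} (both-pos pos-u pos-v) = both-neg
    (subst (Pos a0 as) (sym (neg-involutive u)) pos-u) (subst (Pos a0 as) (sym (neg-involutive v)) pos-v)
  SameSign-neg (both-neg pos-u pos-v) = both-pos pos-u pos-v

  ¬SameSign-0ᶠ : ¬ SameSign 0ᶠ v
  ¬SameSign-0ᶠ (both-pos pos _) = ¬Pos-0ᶠ pos
  ¬SameSign-0ᶠ (both-neg pos _) = ¬Pos-0ᶠ pos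

  SameSign⇒¬SameSign-neg : SameSign u v → ¬ SameSign (neg u) v
  SameSign⇒¬SameSign-neg {u} (both-pos pu _)  (both-pos pnu _)  = Pos⇒¬Pos-neg u pu pnu
  SameSign⇒¬SameSign-neg {v = v} (both-pos _ pv)  (both-neg _ pnv)  = Pos⇒¬Pos-neg v pv pnv
  SameSign⇒¬SameSign-neg {v = v} (both-neg _ pnv) (both-pos _ pv)   = Pos⇒¬Pos-neg v pv pnv
  SameSign⇒¬SameSign-neg {u} (both-neg pnu _) (both-neg pnnu _) = Pos⇒¬Pos-neg (neg u) pnu pnnu

  AbsLt⇒SameSign : ∀ x y → AbsLt a0 as x y → SameSign (y ⊖ x) (y ⊕ x)
  AbsLt⇒SameSign x y (inj₁ (pos₁ , pos₂)) = both-pos pos₁ pos₂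
  AbsLt⇒SameSign x y (inj₂ (pos₁ , pos₂)) = both-neg
    (subst (Pos a0 as) (sym (neg-⊖ y x)) pos₁) (subst (Pos a0 as) (cong neg (⊕-comm x y)) pos₂)

  SameSign⇒AbsLt : ∀ x y → SameSign (y ⊖ x) (y ⊕ x) → AbsLt a0 as x y
  SameSign⇒AbsLt x y (both-pos pos₁ pos₂) = inj₁ (pos₁ , pos₂)
  SameSign⇒AbsLt x y (both-neg pos₁ pos₂) = inj₂
    (subst (Pos a0 as) (neg-⊖ y x) pos₁ , subst (Pos a0 as) (cong neg (⊕-comm y x)) pos₂)

  AbsLt-negˡ : ∀ x y → AbsLt a0 as x y → AbsLt a0 as (neg x) y
  AbsLt-negˡ x y lt = SameSign⇒AbsLt (neg x) y
    (subst (λ u → SameSign u (y ⊖ x)) (sym (⊖-neg y x)) (SameSign-swap (AbsLt⇒SameSign x y lt)))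

  AbsLt-negʳ : ∀ x y → AbsLt a0 as x y → AbsLt a0 as x (neg y)
  AbsLt-negʳ x y lt = SameSign⇒AbsLt x (neg y) (subst₂ SameSign
    (neg-distrib-⊕ y x) (trans (neg-⊖ y x) (⊕-comm x (neg y)))
    (SameSign-neg (SameSign-swap (AbsLt⇒SameSign x y lt))))

  AbsLt-asym : ∀ x y → AbsLt a0 as x y → ¬ AbsLt a0 as y x
  AbsLt-asym x y x<y y<x = SameSign⇒¬SameSign-neg (AbsLt⇒SameSign x y x<y)
    (subst₂ SameSign (sym (neg-⊖ y x)) (⊕-comm x y) (AbsLt⇒SameSign y x y<x))

  AbsLt-irrefl : ∀ x → ¬ AbsLt a0 as x x
  AbsLt-irrefl x x<x =
    ¬SameSign-0ᶠ (subst (λ u → SameSign u (x ⊕ x)) (⊖-self x) (AbsLt⇒SameSign x x x<x))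

  AbsLt-≡±ˡ : ∀ y → x ≡± z → AbsLt a0 as z y → AbsLt a0 as x y
  AbsLt-≡±ˡ y (inj₁ refl) lt = lt
  AbsLt-≡±ˡ {z = z} y (inj₂ refl) lt = AbsLt-negˡ z y lt

  AbsLt-≡±ʳ : ∀ x → y ≡± z → AbsLt a0 as x z → AbsLt a0 as x y
  AbsLt-≡±ʳ x (inj₁ refl) lt = lt
  AbsLt-≡±ʳ {z = z} x (inj₂ refl) lt = AbsLt-negʳ x z lt

  AbsEq-≡± : x ≡± z → y ≡± z → AbsEq a0 as x y
  AbsEq-≡± x≡±z y≡±z = ¬lt x≡±z y≡±z , ¬lt y≡±z x≡±z
    where
    ¬lt : x ≡± z → y ≡± z → ¬ AbsLt a0 as x y
    ¬lt {x} {z} {y} x≡±z y≡±z lt =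
      AbsLt-irrefl z (AbsLt-≡±ʳ z (≡±-sym y≡±z) (AbsLt-≡±ˡ y (≡±-sym x≡±z) lt))

  record Cone (n : ℕ) (w : LF) : Set where
    constructor cone
    field
      E′-nonneg : + 0 ℤ.≤ E′ n w
      E-pos     : + 0 ℤ.< E n w

  Axial⇒±Cone : Axial n z → Cone n z ⊎ Cone n (neg z)
  Axial⇒±Cone {n} {z} (axial e′ (inj₁ e)) =
    inj₁ (cone (subst (+ 0 ℤ.≤_) (sym e′) ℤₚ.≤-refl) (subst (+ 0 ℤ.<_) (sym e) (+<+ (s≤s z≤n))))
  Axial⇒±Cone {n} {z} (axial e′ (inj₂ e)) = inj₂ (cone
    (subst (+ 0 ℤ.≤_) (sym (trans (E′-neg n z) (cong -_ e′))) ℤₚ.≤-refl)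
    (subst (+ 0 ℤ.<_) (sym (trans (E-neg n z) (cong -_ e))) (+<+ (s≤s z≤n))))

  ±Cone⇒E≢0 : Cone n w ⊎ Cone n (neg w) → E n w ≢ + 0
  ±Cone⇒E≢0 (inj₁ (cone _ 0<e)) e≡0 = ℤₚ.<-irrefl (sym e≡0) 0<e
  ±Cone⇒E≢0 {n} {w} (inj₂ (cone _ 0<-e)) e≡0 =
    ℤₚ.<-irrefl (sym (trans (E-neg n w) (cong -_ e≡0))) 0<-e

  E′-pos⇒Cone-suc : + 0 ℤ.< E′ n w → + 0 ℤ.≤ E n w → Cone (suc n) w
  E′-pos⇒Cone-suc {n} {w} 0<e′ 0≤e =
    cone 0≤e (subst (+ 0 ℤ.<_) (sym (E-suc n w)) (0<a*e+e′ʳ (as n) 0≤e 0<e′))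

  module _ (as≥1 : ∀ n → 1 ≤ as n) where

    Cone-suc : Cone n w → Cone (suc n) w
    Cone-suc {n} {w} (cone 0≤e′ 0<e) =
      cone (ℤₚ.<⇒≤ 0<e) (subst (+ 0 ℤ.<_) (sym (E-suc n w)) (0<a*e+e′ˡ (as≥1 n) 0<e 0≤e′))

    Cone-≤ : m ≤ n → Cone m w → Cone n w
    Cone-≤ m≤n = go (ℕₚ.≤⇒≤′ m≤n)
      where
      go : m ≤′ n → Cone m w → Cone n w
      go ≤′-refl       w∈cone = w∈cone
      go (≤′-step m≤n) w∈cone = Cone-suc (go m≤n w∈cone)

    Cone⇒Pos : Cone n w → Pos a0 as w
    Cone⇒Pos {n} w∈cone = n , λ k n≤k → Cone.E-pos (Cone-≤ n≤k w∈cone)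

    nonneg⇒Pos : ∀ n w {a b} → E′ n w ≡ a → E n w ≡ b →
                 + 0 ℤ.≤ a → + 0 ℤ.≤ b → + 0 ℤ.< a ⊎ + 0 ℤ.< b → Pos a0 as w
    nonneg⇒Pos n w refl refl _   0≤b (inj₁ 0<a) = Cone⇒Pos (E′-pos⇒Cone-suc {n} {w} 0<a 0≤b)
    nonneg⇒Pos n w refl refl 0≤a _   (inj₂ 0<b) = Cone⇒Pos (cone {n} {w} 0≤a 0<b)

    -- w − z has coordinates (E′ n w, E n w ∓ 1): still nonnegative, and nonzero unless w = z.
    Cone-⊖-axial : Cone n w → Axial n z → Pos a0 as (w ⊖ z) ⊎ w ≡ z
    Cone-⊖-axial {n} {w} {z} (cone 0≤a 0<b) (axial z′≡0 unit) = by-unit unit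
      where
      a-same : E′ n (w ⊖ z) ≡ E′ n w
      a-same = trans (E′-⊖ n w z) (trans (cong (_-_ (E′ n w)) z′≡0) (ℤₚ.+-identityʳ (E′ n w)))
      b-shift : ∀ {e} → E n z ≡ e → E n (w ⊖ z) ≡ E n w - e
      b-shift z≡e = trans (E-⊖ n w z) (cong (_-_ (E n w)) z≡e)
      0<b+1 : + 0 ℤ.< E n w + + 1
      0<b+1 = ℤₚ.+-mono-<-≤ 0<b (+≤+ z≤n)
      by-unit : IsUnit (E n z) → Pos a0 as (w ⊖ z) ⊎ w ≡ z
      by-unit (inj₂ z≡-1) =
        inj₁ (nonneg⇒Pos n (w ⊖ z) a-same (b-shift z≡-1) 0≤a (ℤₚ.<⇒≤ 0<b+1) (inj₂ 0<b+1))
      by-unit (inj₁ z≡1) with decrement-cases 0≤a 0<b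
      ... | inj₁ (0≤b-1 , pos) = inj₁ (nonneg⇒Pos n (w ⊖ z) a-same (b-shift z≡1) 0≤a 0≤b-1 pos)
      ... | inj₂ (a≡0 , b≡1)   =
        inj₂ (coordinates-injective n (trans a≡0 (sym z′≡0)) (trans b≡1 (sym z≡1)))

    best-in-cone : ∀ n w → Cone n w → AbsLt a0 as (ζ n) w ⊎ w ≡± ζ n
    best-in-cone n w w∈cone =
      combine (Cone-⊖-axial w∈cone (Axial-ζ n)) (Cone-⊖-axial w∈cone (Axial-neg (Axial-ζ n)))
      where
      combine : Pos a0 as (w ⊖ ζ n) ⊎ w ≡ ζ n → Pos a0 as (w ⊖ neg (ζ n)) ⊎ w ≡ neg (ζ n) →
                AbsLt a0 as (ζ n) w ⊎ w ≡± ζ n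
      combine (inj₂ w≡ζ) _           = inj₂ (inj₁ w≡ζ)
      combine (inj₁ _)   (inj₂ w≡-ζ) = inj₂ (inj₂ w≡-ζ)
      combine (inj₁ w-ζ) (inj₁ w+ζ)  = inj₁ (inj₁ (w-ζ , subst (Pos a0 as) (⊖-neg w (ζ n)) w+ζ))

    -- |E′ n w · qₙ − E n w · qₙ₋₁| = |m| < qₙ forces the coordinates of w to share a sign,
    -- so ±w lies in the cone.
    best-approximation : ∀ n w → 0 < ∣ proj₁ w ∣ → ∣ proj₁ w ∣ < den n →
                         AbsLt a0 as (ζ n) w ⊎ w ≡± ζ n
    best-approximation n w 0<∣m∣ ∣m∣<q = by-sign
      (small-cross⇒same-sign (den n) (den′ n) (E′ n w) (E n w)
        (subst (0 <_) ∣m∣≡∣X∣ 0<∣m∣) (subst (_< den n) ∣m∣≡∣X∣ ∣m∣<q))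
      where
      ∣m∣≡∣X∣ : ∣ proj₁ w ∣ ≡ ∣ E′ n w * + den n - E n w * + den′ n ∣
      ∣m∣≡∣X∣ = sym (begin
        ∣ E′ n w * + den n - E n w * + den′ n ∣
          ≡⟨ cong ∣_∣ (cong₂ (λ a b → E′ n w * a - E n w * b) (Q≡den n) (Q′≡den′ n)) ⟨
        ∣ E′ n w * Q n - E n w * Q′ n ∣         ≡⟨ cong ∣_∣ (E-inverse₁ n w) ⟩
        ∣ proj₁ w * det n ∣                     ≡⟨ ∣i*e∣≡∣i∣ (proj₁ w) (det-unit n) ⟩
        ∣ proj₁ w ∣                             ∎)
        where open ≡-Reasoning
      by-sign : (+ 0 ℤ.≤ E′ n w × + 0 ℤ.< E n w) ⊎ (E′ n w ℤ.≤ + 0 × E n w ℤ.< + 0) →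
                AbsLt a0 as (ζ n) w ⊎ w ≡± ζ n
      by-sign (inj₁ (0≤a , 0<b)) = best-in-cone n w (cone 0≤a 0<b)
      by-sign (inj₂ (a≤0 , b<0)) =
        Sum.map (subst (AbsLt a0 as (ζ n)) (neg-involutive w) ∘ AbsLt-negʳ (ζ n) (neg w)) neg-≡±
          (best-in-cone n (neg w) (cone
            (subst (+ 0 ℤ.≤_) (sym (E′-neg n w)) (ℤₚ.neg-mono-≤ a≤0))
            (subst (+ 0 ℤ.<_) (sym (E-neg n w)) (ℤₚ.neg-mono-< b<0))))

    den-pos : ∀ n → 1 ≤ den n
    den-pos zero    = s≤s z≤n
    den-pos (suc n) = ℕₚ.≤-trans (ℕₚ.*-mono-≤ (as≥1 n) (den-pos n)) (ℕₚ.m≤m+n _ (den′ n))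

    den-step : ∀ n → den n ℕ.+ den′ n ≤ den (suc n)
    den-step n = ℕₚ.+-monoˡ-≤ (den′ n)
      (subst (_≤ as n ℕ.* den n) (ℕₚ.*-identityˡ (den n)) (ℕₚ.*-monoˡ-≤ (den n) (as≥1 n)))

    den≤den-suc : ∀ n → den n ≤ den (suc n)
    den≤den-suc n = ℕₚ.≤-trans (ℕₚ.m≤m+n (den n) (den′ n)) (den-step n)

    den-mono : m ≤ n → den m ≤ den n
    den-mono m≤n = go (ℕₚ.≤⇒≤′ m≤n)
      where
      go : m ≤′ n → den m ≤ den n
      go ≤′-refl       = ℕₚ.≤-refl
      go (≤′-step m≤n) = ℕₚ.≤-trans (go m≤n) (den≤den-suc _)

    den-strict : ∀ n → den (suc n) < den (suc (suc n))
    den-strict n = ℕₚ.<-≤-trans (ℕₚ.m<m+n (den (suc n)) (den-pos n)) (den-step (suc n))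

    den-cancel-< : den m < den n → m < n
    den-cancel-< {m} {n} lt with m ℕₚ.<? n
    ... | yes m<n = m<n
    ... | no  m≮n = contradiction lt (ℕₚ.≤⇒≯ (den-mono (ℕₚ.≮⇒≥ m≮n)))

    n<den[1+n] : ∀ n → n < den (suc n)
    n<den[1+n] zero    = den-pos 1
    n<den[1+n] (suc n) = ℕₚ.≤-trans (s≤s (n<den[1+n] n)) (den-strict n)

    n≤den : ∀ n → n ≤ den n
    n≤den zero    = z≤n
    n≤den (suc n) = n<den[1+n] n

    den+den≤den[2+n] : ∀ n → den n ℕ.+ den n ≤ den (suc (suc n))
    den+den≤den[2+n] n = ℕₚ.≤-trans (ℕₚ.+-monoˡ-≤ (den n) (den≤den-suc n)) (den-step (suc n))

    den+den≤den[1+n] : 2 ≤ as n → den n ℕ.+ den n ≤ den (suc n)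
    den+den≤den[1+n] {n} 2≤a = ℕₚ.≤-trans
      (subst (_≤ as n ℕ.* den n) (cong (den n ℕ.+_) (ℕₚ.+-identityʳ (den n))) (ℕₚ.*-monoˡ-≤ (den n) 2≤a))
      (ℕₚ.m≤m+n _ (den′ n))

    rank-exists : ∀ m → ∃ (Rank m)
    rank-exists m = search (suc m) 0 z≤n (n<den[1+n] m)
      where
      search : ∀ j n → den′ n ≤ m → m < den (n ℕ.+ j) → ∃ (Rank m)
      search zero    n lo hi = n , rank lo (subst (λ i → m < den i) (ℕₚ.+-identityʳ n) hi)
      search (suc j) n lo hi with m ℕₚ.<? den n
      ... | yes m<den = n , rank lo m<den
      ... | no  m≮den = search j (suc n) (ℕₚ.≮⇒≥ m≮den) (subst (λ i → m < den i) (ℕₚ.+-suc n j) hi)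

    rank-mono : m ≤ N → Rank m n → Rank N k → n ≤ k
    rank-mono {n = zero}  _   _        _        = z≤n
    rank-mono {n = suc n} m≤N (rank lo _) (rank _ hi) =
      den-cancel-< (ℕₚ.≤-<-trans lo (ℕₚ.≤-<-trans m≤N hi))

    rank-above : den j ≤ m → Rank m n → j < n
    rank-above den≤m (rank _ hi) = den-cancel-< (ℕₚ.≤-<-trans den≤m hi)

    -- D_q(N) = |ζ n| where n is the rank of max(q, N − q)

    E-ζ≢0 : m ≤ n → E n (ζ m) ≢ + 0
    E-ζ≢0 {m} {n} m≤n =
      ±Cone⇒E≢0 {n} {ζ m} (Sum.map (Cone-≤ m≤n) (Cone-≤ m≤n) (Axial⇒±Cone (Axial-ζ m)))

    ζ-decreasing : ∀ {m n} → 1 ≤ m → m < n → AbsLt a0 as (ζ n) (ζ m)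
    ζ-decreasing {suc m} {suc (suc n)} _ (s≤s (s≤s m≤n)) =
      Sum.[ id , (λ same → contradiction (E′≡0 same) (E-ζ≢0 (s≤s m≤n))) ]′
        (best-approximation (suc (suc n)) (ζ (suc m)) 0<∣Q∣ ∣Q∣<den)
      where
      den≡∣Q∣ : den m ≡ ∣ Q m ∣
      den≡∣Q∣ = sym (cong ∣_∣ (Q≡den m))
      0<∣Q∣ : 0 < ∣ Q m ∣
      0<∣Q∣ = subst (0 <_) den≡∣Q∣ (den-pos m)
      ∣Q∣<den : ∣ Q m ∣ < den (suc (suc n))
      ∣Q∣<den = subst (_< den (suc (suc n))) den≡∣Q∣
        (ℕₚ.≤-<-trans (den-mono (ℕₚ.≤-trans m≤n (ℕₚ.n≤1+n n))) (den-strict n))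
      E′≡0 : ζ (suc m) ≡± ζ (suc (suc n)) → E (suc n) (ζ (suc m)) ≡ + 0
      E′≡0 same = trans (sym (E′-suc (suc n) (ζ (suc m))))
        (Axial.E′≡0 (Axial-≡± same (Axial-ζ (suc (suc n)))))

    best-in-window : ∀ w → Rank (radius N q) n → Offset N q (proj₁ w) →
                     AbsLt a0 as (ζ n) w ⊎ w ≡± ζ n
    best-in-window {n = n} w (rank _ r<den) offset =
      best-approximation n w (proj₁ bounds) (ℕₚ.≤-<-trans (proj₂ bounds) r<den)
      where bounds = Offset-bounds offset

    ζ-in-window : q ≤ N → Rank (radius N q) n → 1 ≤ n →
                  ∃[ x ] (x ≡± ζ n × Offset N q (proj₁ x))
    ζ-in-window {q} {N} {suc n} q≤N (rank c≤r _) _ with den n ℕₚ.≤? q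
    ... | yes c≤q = ζ (suc n) , inj₁ refl , q ∸ den n , ℕₚ.≤-trans (ℕₚ.m∸n≤m q (den n)) q≤N ,
      ℕₚ.<⇒≢ (ℕₚ.∸-monoʳ-< (den-pos n) c≤q) ,
      trans (Q≡den n) (sym (trans (ℤₚ.m-n≡m⊖n q (q ∸ den n))
        (trans (ℤₚ.⊖-≥ (ℕₚ.m∸n≤m q (den n))) (cong +_ (ℕₚ.m∸[m∸n]≡n c≤q)))))
    ... | no c≰q = neg (ζ (suc n)) , inj₂ refl , q ℕ.+ den n ,
      subst (q ℕ.+ den n ≤_) (ℕₚ.m+[n∸m]≡n q≤N) (ℕₚ.+-monoʳ-≤ q (≤⊔⇒≤ʳ c≤r c≰q)) ,
      ℕₚ.>⇒≢ (ℕₚ.m<m+n q (den-pos n)) ,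
      trans (cong -_ (Q≡den n))
        (sym (trans (cong (_-_ (+ q)) (ℤₚ.pos-+ q (den n))) (lemma (+ q) (+ den n))))
      where
      lemma : ∀ a b → a - (a + b) ≡ - b
      lemma = solve-∀

    IsD-of-≡± : Rank (radius N q) n → y ≡± ζ n → Offset N q (proj₁ y) → IsD a0 as N q y
    IsD-of-≡± {N} {q} {n} {y} rank-r y≡±ζ offset = offset , minimal
      where
      minimal : ∀ k → k ≤ N → k ≢ q → ∀ t → ¬ AbsLt a0 as (+ q - + k , t) y
      minimal k k≤N k≢q t w<y = Sum.[
          (λ ζ<w → AbsLt-asym y (+ q - + k , t) (AbsLt-≡±ˡ (+ q - + k , t) y≡±ζ ζ<w) w<y)
        , (λ w≡±ζ → proj₁ (AbsEq-≡± w≡±ζ y≡±ζ) w<y) ]′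
        (best-in-window (+ q - + k , t) rank-r (k , k≤N , k≢q , refl))

    D-attained : q ≤ N → Rank (radius N q) n → 1 ≤ n → ∃[ x ] (x ≡± ζ n × IsD a0 as N q x)
    D-attained q≤N rank-r 1≤n with ζ-in-window q≤N rank-r 1≤n
    ... | x , x≡±ζ , offset = x , x≡±ζ , IsD-of-≡± rank-r x≡±ζ offset

    D-unique : ∀ x → q ≤ N → Rank (radius N q) n → 1 ≤ n → IsD a0 as N q x → x ≡± ζ n
    D-unique {q = q} {N = N} {n = n} x q≤N rank-r 1≤n (offset , minimal) =
      Sum.[ (λ ζ<x → ⊥-elim (undercut ζ<x (ζ-in-window q≤N rank-r 1≤n))) , id ]′
        (best-in-window x rank-r offset)
      where
      undercut : AbsLt a0 as (ζ n) x → ¬ (∃[ y ] (y ≡± ζ n × Offset N q (proj₁ y)))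
      undercut ζ<x (y , y≡±ζ , k , k≤N , k≢q , y₁≡) = minimal k k≤N k≢q (proj₂ y)
        (subst (λ d → AbsLt a0 as (d , proj₂ y) x) y₁≡ (AbsLt-≡±ˡ x y≡±ζ ζ<x))

    SameD-of-rank : i ≤ N → j ≤ N → Rank (radius N i) n → Rank (radius N j) n → 1 ≤ n →
                    SameD a0 as N i j
    SameD-of-rank i≤N j≤N rank-i rank-j 1≤n x y Dx Dy =
      AbsEq-≡± (D-unique x i≤N rank-i 1≤n Dx) (D-unique y j≤N rank-j 1≤n Dy)

    DiffD-of-rank< : i ≤ N → j ≤ N → Rank (radius N i) n₁ → Rank (radius N j) n₂ →
                     1 ≤ n₂ → n₂ < n₁ → DiffD a0 as N i j
    DiffD-of-rank< {i = i} {N = N} {j = j} {n₁ = n₁} {n₂ = n₂} i≤N j≤N rank-i rank-j 1≤n₂ n₂<n₁ =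
      differ (D-attained i≤N rank-i (ℕₚ.≤-trans 1≤n₂ (ℕₚ.<⇒≤ n₂<n₁))) (D-attained j≤N rank-j 1≤n₂)
      where
      differ : ∃[ x ] (x ≡± ζ n₁ × IsD a0 as N i x) → ∃[ y ] (y ≡± ζ n₂ × IsD a0 as N j y) →
               DiffD a0 as N i j
      differ (x , x≡±ζ , Dx) (y , y≡±ζ , Dy) = x , y , Dx , Dy , λ x≈y →
        proj₁ x≈y (AbsLt-≡±ʳ x y≡±ζ (AbsLt-≡±ˡ (ζ n₂) x≡±ζ (ζ-decreasing 1≤n₂ n₂<n₁)))

    DiffD-sym : DiffD a0 as N i j → DiffD a0 as N j i
    DiffD-sym (x , y , Dx , Dy , x≉y) = y , x , Dy , Dx , x≉y ∘ swap

    -- Upper bounds on g: max(q, N − q) ∈ [N/2, N] meets few ranks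

    gAtMost-of-rank : ∀ c k → Rank N (c ℕ.+ k) → den k ℕ.+ den k ≤ N → gAtMost a0 as N c
    gAtMost-of-rank {N} c k rank-N gap f f≤N =
      same-rank (pigeonhole-window c k (λ i → proj₁ (rank-of i)) above below)
      where
      rank-of : ∀ i → ∃ (Rank (radius N (f i)))
      rank-of i = rank-exists (radius N (f i))
      above : ∀ i → k < proj₁ (rank-of i)
      above i = rank-above (m+m≤n+n⇒m≤n (ℕₚ.≤-trans gap (≤-radius+radius (f≤N i)))) (proj₂ (rank-of i))
      below : ∀ i → proj₁ (rank-of i) ≤ c ℕ.+ k
      below i = rank-mono (radius-≤ (f≤N i)) (proj₂ (rank-of i)) rank-N
      same-rank : ∃[ i ] ∃[ j ] (i ≢ j × proj₁ (rank-of i) ≡ proj₁ (rank-of j)) →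
                  ∃[ i ] ∃[ j ] (i ≢ j × SameD a0 as N (f i) (f j))
      same-rank (i , j , i≢j , same) = i , j , i≢j ,
        SameD-of-rank (f≤N i) (f≤N j) (proj₂ (rank-of i))
          (subst (Rank (radius N (f j))) (sym same) (proj₂ (rank-of j))) (ℕₚ.≤-trans (s≤s z≤n) (above i))

    eventually-gAtMost : ∀ c M → (∀ k → M ≤ k → den k ℕ.+ den k ≤ den′ (c ℕ.+ k)) →
                         ∃[ M′ ] ∀ N → M′ ≤ N → gAtMost a0 as N c
    eventually-gAtMost c M gap = den (c ℕ.+ M) , at
      where
      at : ∀ N → den (c ℕ.+ M) ≤ N → gAtMost a0 as N c
      at N bound with rank-exists N
      ... | K , rank-N = gAtMost-of-rank c d rank-N′ (ℕₚ.≤-trans (gap d M≤d) (Rank.lower rank-N′))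
        where
        c+M<K = rank-above bound rank-N
        c≤K = ℕₚ.≤-trans (ℕₚ.m≤m+n c M) (ℕₚ.<⇒≤ c+M<K)
        d = K ∸ c
        rank-N′ : Rank N (c ℕ.+ d)
        rank-N′ = subst (Rank N) (sym (ℕₚ.m+[n∸m]≡n c≤K)) rank-N
        M≤d : M ≤ d
        M≤d = subst (_≤ d) (ℕₚ.m+n∸m≡n c M) (ℕₚ.∸-monoˡ-≤ c (ℕₚ.<⇒≤ c+M<K))

    gAtMost-3-eventually : ∃[ M ] ∀ N → M ≤ N → gAtMost a0 as N 3
    gAtMost-3-eventually = eventually-gAtMost 3 0 (λ k _ → den+den≤den[2+n] k)

    gAtMost-2-eventually : FinManyOnes a0 as → ∃[ M ] ∀ N → M ≤ N → gAtMost a0 as N 2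
    gAtMost-2-eventually (M , not-one) = eventually-gAtMost 2 M λ k M≤k →
      den+den≤den[1+n] (ℕₚ.≤∧≢⇒< (as≥1 k) λ 1≡a →
        not-one (suc k) (ℕₚ.≤-trans M≤k (ℕₚ.n≤1+n k)) (cong +_ (sym 1≡a)))

    gAtLeast-of-ranks : ∀ {c} n₀ (f : Fin c → ℕ) → 1 ≤ n₀ → (∀ i → f i ≤ N) →
                        (∀ i → Rank (radius N (f i)) (toℕ i ℕ.+ n₀)) → gAtLeast a0 as N c
    gAtLeast-of-ranks {N} n₀ f 1≤n₀ f≤N ranked = f , f≤N , distinct
      where
      1≤rank : ∀ i → 1 ≤ toℕ i ℕ.+ n₀
      1≤rank i = ℕₚ.≤-trans 1≤n₀ (ℕₚ.m≤n+m n₀ (toℕ i))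
      distinct : ∀ i j → i ≢ j → DiffD a0 as N (f i) (f j)
      distinct i j i≢j with ℕₚ.<-cmp (toℕ i) (toℕ j)
      ... | tri< i<j _ _ = DiffD-sym (DiffD-of-rank< (f≤N j) (f≤N i) (ranked j) (ranked i)
                                        (1≤rank i) (ℕₚ.+-monoˡ-< n₀ i<j))
      ... | tri≈ _ i≡j _ = contradiction (Finₚ.toℕ-injective i≡j) i≢j
      ... | tri> _ _ j<i = DiffD-of-rank< (f≤N i) (f≤N j) (ranked i) (ranked j)
                             (1≤rank j) (ℕₚ.+-monoˡ-< n₀ j<i)

    Rank-top : ∀ n → Rank (radius (den (suc n)) (den (suc n))) (suc (suc n))
    Rank-top n = Rank-⊔ ℕₚ.≤-refl (den-strict n)
      (subst (_< den (suc (suc n))) (sym (ℕₚ.n∸n≡0 (den (suc n)))) (den-pos _))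

    gAtLeast-2-at : ∀ s → gAtLeast a0 as (den (suc (suc s))) 2
    gAtLeast-2-at s = gAtLeast-of-ranks (suc (suc s)) points (s≤s z≤n) bounded ranked
      where
      N₀ = den (suc (suc s))
      1≤N₀ = den-pos (suc (suc s))
      points : Fin 2 → ℕ
      points zero       = N₀ ∸ 1
      points (suc zero) = N₀
      bounded : ∀ i → points i ≤ N₀
      bounded zero       = ℕₚ.m∸n≤m N₀ 1
      bounded (suc zero) = ℕₚ.≤-refl
      ranked : ∀ i → Rank (radius N₀ (points i)) (toℕ i ℕ.+ suc (suc s))
      ranked zero = Rank-⊔ (ℕₚ.<⇒≤pred (den-strict s)) (ℕₚ.∸-monoʳ-< (s≤s z≤n) 1≤N₀)
        (subst (_< N₀) (sym (ℕₚ.m∸[m∸n]≡n 1≤N₀)) (ℕₚ.≤-<-trans (den-pos (suc s)) (den-strict s)))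
      ranked (suc zero) = Rank-top (suc s)

    gAtLeast-3-at : ∀ s → 2 ≤ den s → as (suc (suc s)) ≡ 1 → gAtLeast a0 as (den (suc (suc (suc s)))) 3
    gAtLeast-3-at s 2≤den a≡1 = gAtLeast-of-ranks (suc (suc s)) points (s≤s z≤n) bounded ranked
      where
      B = den (suc s)
      A = den (suc (suc s))
      N₀ = den (suc (suc (suc s)))
      1≤A = den-pos (suc (suc s))
      A≤N₀ = den≤den-suc (suc (suc s))
      N₀≡A+B : N₀ ≡ A ℕ.+ B
      N₀≡A+B = cong (ℕ._+ B) (trans (cong (ℕ._* A) a≡1) (ℕₚ.*-identityˡ A))
      2+B≤A : 2 ℕ.+ B ≤ A
      2+B≤A = ℕₚ.≤-trans (subst (_≤ B ℕ.+ den s) (ℕₚ.+-comm B 2) (ℕₚ.+-monoʳ-≤ B 2≤den)) (den-step (suc s))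
      N₀∸[A∸1]≡1+B : N₀ ∸ (A ∸ 1) ≡ suc B
      N₀∸[A∸1]≡1+B = begin
        N₀ ∸ (A ∸ 1)                     ≡⟨ cong (_∸ (A ∸ 1)) N₀≡A+B ⟩
        A ℕ.+ B ∸ (A ∸ 1)               ≡⟨ cong (λ a → a ℕ.+ B ∸ (A ∸ 1)) (ℕₚ.m∸n+n≡m 1≤A) ⟨
        (A ∸ 1 ℕ.+ 1) ℕ.+ B ∸ (A ∸ 1)   ≡⟨ cong (_∸ (A ∸ 1)) (ℕₚ.+-assoc (A ∸ 1) 1 B) ⟩
        (A ∸ 1) ℕ.+ suc B ∸ (A ∸ 1)     ≡⟨ ℕₚ.m+n∸m≡n (A ∸ 1) (suc B) ⟩
        suc B                           ∎
        where open ≡-Reasoning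
      points : Fin 3 → ℕ
      points zero             = A ∸ 1
      points (suc zero)       = A
      points (suc (suc zero)) = N₀
      bounded : ∀ i → points i ≤ N₀
      bounded zero             = ℕₚ.≤-trans (ℕₚ.m∸n≤m A 1) A≤N₀
      bounded (suc zero)       = A≤N₀
      bounded (suc (suc zero)) = ℕₚ.≤-refl
      ranked : ∀ i → Rank (radius N₀ (points i)) (toℕ i ℕ.+ suc (suc s))
      ranked zero = Rank-⊔ (ℕₚ.<⇒≤pred (den-strict s)) (ℕₚ.∸-monoʳ-< (s≤s z≤n) 1≤A)
        (subst (_< A) (sym N₀∸[A∸1]≡1+B) 2+B≤A)
      ranked (suc zero)       = Rank-⊔ ℕₚ.≤-refl (den-strict (suc s)) (ℕₚ.∸-monoʳ-< 1≤A A≤N₀)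
      ranked (suc (suc zero)) = Rank-top (suc (suc s))

    gAtLeast-2-infinitely-often : ∀ M → ∃[ N ] (M ≤ N × gAtLeast a0 as N 2)
    gAtLeast-2-infinitely-often M =
      den (suc (suc M)) , ℕₚ.≤-trans (ℕₚ.m≤n+m M 2) (n≤den (suc (suc M))) , gAtLeast-2-at M

    gAtLeast-3-infinitely-often : InfManyOnes a0 as → ∀ M → ∃[ N ] (M ≤ N × gAtLeast a0 as N 3)
    gAtLeast-3-infinitely-often ones M with ones (5 ℕ.+ M)
    ... | n , 5+M≤n , aₙ≡1 with ℕₚ.m≤n⇒∃[o]m+o≡n 5+M≤n
    ...   | o , refl = den (suc (suc (suc s))) , M≤N , gAtLeast-3-at s 2≤den[s] (ℤₚ.+-injective aₙ≡1)
      where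
      s = suc (suc (M ℕ.+ o))
      2≤den[s] : 2 ≤ den s
      2≤den[s] = ℕₚ.≤-trans (s≤s (s≤s z≤n)) (n≤den s)
      M≤N : M ≤ den (suc (suc (suc s)))
      M≤N = ℕₚ.≤-trans (ℕₚ.≤-trans (ℕₚ.m≤m+n M o) (ℕₚ.m≤n+m (M ℕ.+ o) 5)) (n≤den _)

theorem5 : (a0 : ℤ) (as : ℕ → ℕ) → (∀ n → 1 ≤ as n) →
    (InfManyOnes a0 as → LimsupG a0 as 3)
    × (FinManyOnes a0 as → LimsupG a0 as 2)
theorem5 a0 as as≥1 =
    (λ ones → gAtMost-3-eventually a0 as as≥1 , gAtLeast-3-infinitely-often a0 as as≥1 ones)
  , (λ few-ones → gAtMost-2-eventually a0 as as≥1 few-ones , gAtLeast-2-infinitely-often a0 as as≥1)
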